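{- Let $G=(V,E)$ be a finite simple graph and let $D$ be an orientation of $G$. For each $v\in V$, let $L(v)$ be a list of $d^+_D(v)+1$ positive integers. Suppose that for every odd (undirected) cycle $C$ of $G$ there exists $u\in V(C)$ such that $u$ is simplicial in $G$ and $d^+_D(u)=0$. Then there is an additive coloring of $G$ that assigns to each $v\in V$ an element of $L(v)$.
   Context: A vertex is simplicial if its neighbors form a clique. An additive coloring of $G$ is a function $\ell:V(G)\to\mathbb{N}$ (positive integers) such that $c(v)=\sum_{u\in N_G(v)}\ell(u)$ satisfies $c(u)\neq c(v)$ whenever $\{u,v\}\in E(G)$. $d^+_D(v)$ is the out-degree of $v$ in $D$. -}

module Defs where

open import Data.Nat using (ℕ; zero; suc; _+_; _*_; _≤_)
open import Data.Fin using (Fin)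
open import Data.Bool using (Bool; true; false; T; if_then_else_)
open import Data.List using (List; []; _∷_; _++_; [_]; length; map; allFin)
open import Data.Nat.ListAction using (sum)
open import Data.List.Membership.Propositional using (_∈_)
open import Data.List.Relation.Unary.Unique.Propositional using (Unique)
open import Data.List.Relation.Unary.All using (All)
open import Data.Product using (Σ; _×_; ∃; ∃-syntax)
open import Data.Sum using (_⊎_)
open import Data.Empty using (⊥)
open import Data.Unit using (⊤)
open import Relation.Binary.PropositionalEquality using (_≡_; _≢_)

record Graph (n : ℕ) : Set where
  field
    adj    : Fin n → Fin n → Bool
    sym    : ∀ u v → adj u v ≡ adj v u
    irrefl : ∀ v → adj v v ≡ false
open Graph public

record Orientation {n : ℕ} (G : Graph n) : Set where
  field
    arc     : Fin n → Fin n → Bool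
    arc⇒adj : ∀ u v → T (arc u v) → T (adj G u v)
    adj⇒arc : ∀ u v → T (adj G u v) → T (arc u v) ⊎ T (arc v u)
    antisym : ∀ u v → T (arc u v) → T (arc v u) → ⊥
open Orientation public

[_]ᵇ : Bool → ℕ
[ true ]ᵇ = 1
[ false ]ᵇ = 0

outdeg : ∀ {n} {G : Graph n} → Orientation G → Fin n → ℕ
outdeg {n} D v = sum (map (λ w → [ arc D v w ]ᵇ) (allFin n))

neighbourSum : ∀ {n} → Graph n → (Fin n → ℕ) → Fin n → ℕ
neighbourSum {n} G ℓ v =
  sum (map (λ u → if adj G v u then ℓ u else 0) (allFin n))

IsAdditiveColoring : ∀ {n} → Graph n → (Fin n → ℕ) → Set
IsAdditiveColoring {n} G ℓ =
  (∀ v → 1 ≤ ℓ v) ×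
  (∀ u v → T (adj G u v) → neighbourSum G ℓ u ≢ neighbourSum G ℓ v)

Simplicial : ∀ {n} → Graph n → Fin n → Set
Simplicial G v = ∀ u w → T (adj G v u) → T (adj G v w) → u ≢ w → T (adj G u w)

ConsecAdj : ∀ {n} → Graph n → List (Fin n) → Set
ConsecAdj G []           = ⊤
ConsecAdj G (x ∷ [])     = ⊤
ConsecAdj G (x ∷ y ∷ xs) = T (adj G x y) × ConsecAdj G (y ∷ xs)

IsCycle : ∀ {n} → Graph n → List (Fin n) → Set
IsCycle G []       = ⊥
IsCycle G (x ∷ xs) =
  Unique (x ∷ xs) × 3 ≤ length (x ∷ xs) × ConsecAdj G ((x ∷ xs) ++ [ x ])

IsOddCycle : ∀ {n} → Graph n → List (Fin n) → Set
IsOddCycle G cs = IsCycle G cs × ∃[ k ] length cs ≡ suc (2 * k)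

-- Let the vertices that are not simplicial sinks be 2-coloured by signs σ_w;
-- this is possible since every odd cycle contains a simplicial sink. To each
-- arc u → v attach the linear form
--   F_uv(z) = ∑_w σ_u σ_w ([v ~ w] - [u ~ w]) z_w,
-- which at z_w = σ_w ℓ(w) equals σ_u (c(v) - c(u)). Choosing from every form
-- the variable of its tail gives the monomial ∏_w z_w^(d⁺(w)) of top degree.
-- The colouring (and simpliciality, for common neighbours of the ends of an
-- arc) makes every coefficient at a vertex of positive out-degree nonnegative
-- and every form's coefficient at its own tail positive, so this monomial has
-- a positive coefficient in ∏ F_uv. By the Combinatorial Nullstellensatz the
-- product does not vanish at some point of the grid ∏_w σ_w L(w), which
-- yields ℓ with c(u) ≠ c(v) along every arc, hence along every edge.
-- The Nullstellensatz is proved without polynomials: on a list of t + 1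
-- distinct integers there are integer weights whose moments of order < t
-- vanish and whose t-th moment does not, and integrating against the product
-- of such weightings over the grid extracts the top coefficient.

module Submission where

open import Defs hiding (sym)

open import Algebra.Bundles using (Monoid)
open import Data.Nat as ℕ using (ℕ; zero; suc; _≤_; _<_)
import Data.Nat.Properties as ℕP
open import Data.Nat.ListAction using (sum)
import Data.Nat.Tactic.RingSolver as ℕ-Solver
open import Data.Integer as ℤ using (ℤ; +_; _+_; _*_; -_; _-_; 0ℤ; 1ℤ; -1ℤ; _^_; ∣_∣)
import Data.Integer.Properties as ℤP
open import Data.Integer.Tactic.RingSolver using (solve-∀)
open import Data.Fin using (Fin; zero; suc; toℕ; fromℕ<; _≟_)
import Data.Fin.Properties as FinP
open import Data.Vec using (Vec; []; _∷_; lookup; count)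
open import Data.Bool using (Bool; true; false; T; not; _xor_; if_then_else_)
import Data.Bool.Properties as BoolP
open import Data.List using (List; []; _∷_; _++_; [_]; length; map; filter; concatMap; allFin; tabulate)
import Data.List.Properties as ListP
open import Data.List.Membership.Propositional using (_∈_; find; lose)
import Data.List.Membership.Propositional.Properties as MemP
open import Data.List.Relation.Unary.Any using (Any; here; there; any?)
open import Data.List.Relation.Unary.All as All using (All; []; _∷_)
import Data.List.Relation.Unary.All.Properties as AllP
open import Data.List.Relation.Unary.AllPairs using ([]; _∷_)
open import Data.List.Relation.Unary.Unique.Propositional using (Unique)
import Data.List.Relation.Unary.Unique.Propositional.Properties as UniqueP
open import Data.Product using (Σ; ∃-syntax; _×_; _,_; proj₁; proj₂)
open import Data.Sum using (_⊎_; inj₁; inj₂; [_,_]′)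
open import Data.Empty using (⊥; ⊥-elim)
open import Data.Unit using (tt)
open import Function using (_∘_; _∘′_; Equivalence; case_of_)
open import Relation.Nullary using (Dec; yes; no; does; ¬_; map′)
open import Relation.Nullary.Decidable using (_×-dec_; _→-dec_; ¬?; T?; decidable-stable)
open import Relation.Unary using (Decidable)
open import Relation.Binary.Definitions using (DecidableEquality)
open import Relation.Binary.PropositionalEquality hiding ([_])

open import Algebra.Properties.Semiring.Sum ℤP.+-*-semiring
  using (sum-cong-≗; *-distribˡ-sum; *-distribʳ-sum) renaming (sum to ∑)
open import Algebra.Properties.CommutativeMonoid.Sum ℤP.*-1-commutativeMonoid
  using () renaming (sum to ∏; sum-cong-≗ to ∏-cong; ∑-distrib-+ to ∏-distrib-*; sum-replicate-zero to ∏-ones)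
open import Algebra.Properties.CommutativeMonoid.Sum ℕP.+-0-commutativeMonoid
  using () renaming (sum to ∑ℕ; sum-cong-≗ to ∑ℕ-cong; ∑-distrib-+ to ∑ℕ-distrib-+; sum-replicate-zero to ∑ℕ-zero)

-- Finite sums

module _ {c ℓ} (M : Monoid c ℓ) where
  open Monoid M using (Carrier; _≈_; ε; ∙-congˡ; identityˡ; identityʳ) renaming (trans to ≈-trans)
  open import Algebra.Properties.Monoid.Sum M using (sum-replicate-zero) renaming (sum to ∑ᴹ)

  sum-δ : ∀ {n} (x : Fin n) (f : Fin n → Carrier) → ∑ᴹ (λ w → if does (w ≟ x) then f w else ε) ≈ f x
  sum-δ {suc n} zero    f = ≈-trans (∙-congˡ (sum-replicate-zero n)) (identityʳ (f zero))
  sum-δ {suc n} (suc x) f = ≈-trans (identityˡ _) (sum-δ x (f ∘ suc))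

  sumVec : ∀ {n} k → (Vec (Fin n) k → Carrier) → Carrier
  sumVec zero    F = F []
  sumVec (suc k) F = ∑ᴹ (λ w → sumVec k (F ∘ (w ∷_)))

∑ⱽ : ∀ {n} k → (Vec (Fin n) k → ℤ) → ℤ
∑ⱽ = sumVec ℤP.+-0-monoid

∑ⱽℕ : ∀ {n} k → (Vec (Fin n) k → ℕ) → ℕ
∑ⱽℕ = sumVec ℕP.+-0-monoid

∑ℕ-mono-≤ : ∀ {n} {f g : Fin n → ℕ} → (∀ i → f i ≤ g i) → ∑ℕ f ≤ ∑ℕ g
∑ℕ-mono-≤ {zero}  f≤g = ℕ.z≤n
∑ℕ-mono-≤ {suc n} f≤g = ℕP.+-mono-≤ (f≤g zero) (∑ℕ-mono-≤ (f≤g ∘ suc))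

∑ℕ-≡⇒≗ : ∀ {n} {f g : Fin n → ℕ} → (∀ i → f i ≤ g i) → ∑ℕ f ≡ ∑ℕ g → ∀ i → f i ≡ g i
∑ℕ-≡⇒≗ {suc n} {f} {g} f≤g eq = λ
  { zero    → head-eq
  ; (suc i) → ∑ℕ-≡⇒≗ (f≤g ∘ suc) tail-eq i }
  where
  head-eq : f zero ≡ g zero
  head-eq = ℕP.≤-antisym (f≤g zero)
    (ℕP.+-cancelʳ-≤ (∑ℕ (f ∘ suc)) (g zero) (f zero)
      (ℕP.≤-trans (ℕP.+-monoʳ-≤ (g zero) (∑ℕ-mono-≤ (f≤g ∘ suc))) (ℕP.≤-reflexive (sym eq))))
  tail-eq : ∑ℕ (f ∘ suc) ≡ ∑ℕ (g ∘ suc)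
  tail-eq = ℕP.+-cancelˡ-≡ (f zero) _ _ (trans eq (cong (ℕ._+ ∑ℕ (g ∘ suc)) (sym head-eq)))

≤-∑ℕ : ∀ {n} (f : Fin n → ℕ) i → f i ≤ ∑ℕ f
≤-∑ℕ f zero    = ℕP.m≤m+n (f zero) _
≤-∑ℕ f (suc i) = ℕP.≤-trans (≤-∑ℕ (f ∘ suc) i) (ℕP.m≤n+m _ (f zero))

≤-∑ⱽℕ : ∀ {n} k (F : Vec (Fin n) k → ℕ) φ → F φ ≤ ∑ⱽℕ k F
≤-∑ⱽℕ zero    F []      = ℕP.≤-refl
≤-∑ⱽℕ (suc k) F (w ∷ φ) = ℕP.≤-trans (≤-∑ⱽℕ k (F ∘ (w ∷_)) φ) (≤-∑ℕ (λ w → ∑ⱽℕ k (F ∘ (w ∷_))) w)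

∑-pos : ∀ {n} (f : Fin n → ℕ) → ∑ (λ i → + f i) ≡ + ∑ℕ f
∑-pos {zero}  f = refl
∑-pos {suc n} f = trans (cong (_+_ (+ f zero)) (∑-pos (f ∘ suc))) (sym (ℤP.pos-+ (f zero) _))

∑ⱽ-pos : ∀ {n} k (F : Vec (Fin n) k → ℕ) → ∑ⱽ k (λ φ → + F φ) ≡ + ∑ⱽℕ k F
∑ⱽ-pos zero    F = refl
∑ⱽ-pos (suc k) F = trans (sum-cong-≗ (λ w → ∑ⱽ-pos k (F ∘ (w ∷_)))) (∑-pos (λ w → ∑ⱽℕ k (F ∘ (w ∷_))))

∑ⱽ-cong : ∀ {n} k {F G : Vec (Fin n) k → ℤ} → (∀ φ → F φ ≡ G φ) → ∑ⱽ k F ≡ ∑ⱽ k G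
∑ⱽ-cong zero    F≗G = F≗G []
∑ⱽ-cong (suc k) F≗G = sum-cong-≗ (λ w → ∑ⱽ-cong k (F≗G ∘ (w ∷_)))

*-distribˡ-∑ⱽ : ∀ {n} k c (F : Vec (Fin n) k → ℤ) → c * ∑ⱽ k F ≡ ∑ⱽ k (λ φ → c * F φ)
*-distribˡ-∑ⱽ zero    c F = refl
*-distribˡ-∑ⱽ (suc k) c F =
  trans (*-distribˡ-sum c (λ w → ∑ⱽ k (F ∘ (w ∷_)))) (sum-cong-≗ (λ w → *-distribˡ-∑ⱽ k c (F ∘ (w ∷_))))

∏-zero : ∀ {n} (f : Fin n → ℤ) i → f i ≡ 0ℤ → ∏ f ≡ 0ℤ
∏-zero f zero    fi≡0 = cong (_* ∏ (f ∘ suc)) fi≡0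
∏-zero f (suc i) fi≡0 = trans (cong (f zero *_) (∏-zero (f ∘ suc) i fi≡0)) (ℤP.*-zeroʳ (f zero))

∏-nonzero : ∀ {n} (f : Fin n → ℤ) → (∀ i → f i ≢ 0ℤ) → ∏ f ≢ 0ℤ
∏-nonzero {zero}  f f≢0 ()
∏-nonzero {suc n} f f≢0 eq with ℤP.i*j≡0⇒i≡0∨j≡0 (f zero) eq
... | inj₁ f0≡0 = f≢0 zero f0≡0
... | inj₂ rest = ∏-nonzero (f ∘ suc) (f≢0 ∘ suc) rest

sum-tabulate : ∀ {n} (f : Fin n → ℕ) → sum (tabulate f) ≡ ∑ℕ f
sum-tabulate {zero}  f = refl
sum-tabulate {suc n} f = cong (f zero ℕ.+_) (sum-tabulate (f ∘ suc))

sum-allFin : ∀ {n} (f : Fin n → ℕ) → sum (map f (allFin n)) ≡ ∑ℕ f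
sum-allFin f = trans (cong sum (ListP.map-tabulate (λ i → i) f)) (sum-tabulate f)

length-filter-T : ∀ {a} {A : Set a} (b : A → Bool) xs → length (filter (T? ∘ b) xs) ≡ sum (map ([_]ᵇ ∘ b) xs)
length-filter-T b []       = refl
length-filter-T b (x ∷ xs) with b x
... | true  = cong suc (length-filter-T b xs)
... | false = length-filter-T b xs

∑-distrib-− : ∀ {n} (f g : Fin n → ℤ) → ∑ (λ w → f w - g w) ≡ ∑ f - ∑ g
∑-distrib-− {zero}  f g = refl
∑-distrib-− {suc n} f g = trans (cong (_+_ (f zero - g zero)) (∑-distrib-− (f ∘ suc) (g ∘ suc)))
                                (regroup (f zero) (g zero) (∑ (f ∘ suc)) (∑ (g ∘ suc)))
  where
  regroup : ∀ a b c d → a - b + (c - d) ≡ a + c - (b + d)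
  regroup = solve-∀

does-≟-comm : ∀ {n} (x y : Fin n) → does (x ≟ y) ≡ does (y ≟ x)
does-≟-comm x y with x ≟ y | y ≟ x
... | yes _    | yes _    = refl
... | no  _    | no  _    = refl
... | yes refl | no  x≢x  = ⊥-elim (x≢x refl)
... | no  x≢x  | yes refl = ⊥-elim (x≢x refl)

-- Weightings with prescribed moments

-- A finitely supported ℤ-valued measure on ℤ, as a list of (point , weight) pairs.
Weighting : Set
Weighting = List (ℤ × ℤ)

∫ : Weighting → (ℤ → ℤ) → ℤ
∫ []            f = 0ℤ
∫ ((x , w) ∷ W) f = w * f x + ∫ W f

moment : Weighting → ℕ → ℤ
moment W j = ∫ W (_^ j)

SupportedOn : List ℤ → Weighting → Set
SupportedOn S W = All (λ p → proj₁ p ∈ S) W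

∫-cong : ∀ W {f g : ℤ → ℤ} → (∀ x → f x ≡ g x) → ∫ W f ≡ ∫ W g
∫-cong []            f≗g = refl
∫-cong ((x , w) ∷ W) f≗g = cong₂ _+_ (cong (w *_) (f≗g x)) (∫-cong W f≗g)

∫-cong-supported : ∀ {S} W {f g : ℤ → ℤ} → SupportedOn S W →
                   (∀ {x} → x ∈ S → f x ≡ g x) → ∫ W f ≡ ∫ W g
∫-cong-supported []            []         f≗g = refl
∫-cong-supported ((x , w) ∷ W) (x∈S ∷ sW) f≗g =
  cong₂ _+_ (cong (w *_) (f≗g x∈S)) (∫-cong-supported W sW f≗g)

∫-zero : ∀ W → ∫ W (λ _ → 0ℤ) ≡ 0ℤ
∫-zero []            = refl
∫-zero ((x , w) ∷ W) = cong₂ _+_ (ℤP.*-zeroʳ w) (∫-zero W)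

∫-+ : ∀ W (f g : ℤ → ℤ) → ∫ W (λ x → f x + g x) ≡ ∫ W f + ∫ W g
∫-+ []            f g = refl
∫-+ ((x , w) ∷ W) f g =
  trans (cong (λ r → w * (f x + g x) + r) (∫-+ W f g)) (distribute w (f x) (g x) (∫ W f) (∫ W g))
  where
  distribute : ∀ a b c d e → a * (b + c) + (d + e) ≡ (a * b + d) + (a * c + e)
  distribute = solve-∀

∫-*ˡ : ∀ W c (f : ℤ → ℤ) → ∫ W (λ x → c * f x) ≡ c * ∫ W f
∫-*ˡ []            c f = sym (ℤP.*-zeroʳ c)
∫-*ˡ ((x , w) ∷ W) c f =
  trans (cong (λ r → w * (c * f x) + r) (∫-*ˡ W c f)) (factor w c (f x) (∫ W f))
  where
  factor : ∀ a c b d → a * (c * b) + c * d ≡ c * (a * b + d)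
  factor = solve-∀

∫-*ʳ : ∀ W c (f : ℤ → ℤ) → ∫ W (λ x → f x * c) ≡ ∫ W f * c
∫-*ʳ W c f = begin
  ∫ W (λ x → f x * c) ≡⟨ ∫-cong W (λ x → ℤP.*-comm (f x) c) ⟩
  ∫ W (λ x → c * f x) ≡⟨ ∫-*ˡ W c f ⟩
  c * ∫ W f           ≡⟨ ℤP.*-comm c _ ⟩
  ∫ W f * c           ∎
  where open ≡-Reasoning

shiftedProduct : ℤ → List ℤ → ℤ
shiftedProduct b []       = 1ℤ
shiftedProduct b (y ∷ ys) = (y - b) * shiftedProduct b ys

shiftedProductWithout : ℤ → ℤ → List ℤ → ℤ
shiftedProductWithout b x [] = 1ℤ
shiftedProductWithout b x (y ∷ ys) with x ℤP.≟ y
... | yes _ = shiftedProduct b ys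
... | no  _ = (y - b) * shiftedProductWithout b x ys

shiftedProductWithout-* : ∀ b {x} ys → x ∈ ys →
  shiftedProductWithout b x ys * (x - b) ≡ shiftedProduct b ys
shiftedProductWithout-* b {x} (y ∷ ys) x∈ with x ℤP.≟ y | x∈
... | yes refl | _         = ℤP.*-comm (shiftedProduct b ys) (x - b)
... | no  x≢y  | here x≡y  = ⊥-elim (x≢y x≡y)
... | no  _    | there x∈′ =
  trans (ℤP.*-assoc (y - b) _ (x - b)) (cong ((y - b) *_) (shiftedProductWithout-* b ys x∈′))

shiftedProduct-nonzero : ∀ b ys → All (λ y → b ≢ y) ys → shiftedProduct b ys ≢ 0ℤ
shiftedProduct-nonzero b (y ∷ ys) (b≢y ∷ b∉ys) eq with ℤP.i*j≡0⇒i≡0∨j≡0 (y - b) eq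
... | inj₁ y-b≡0 = b≢y (sym (ℤP.i-j≡0⇒i≡j y b y-b≡0))
... | inj₂ rest  = shiftedProduct-nonzero b ys b∉ys rest

geometricSum : ℤ → ℤ → ℕ → ℤ
geometricSum b x zero    = 0ℤ
geometricSum b x (suc j) = x ^ j + b * geometricSum b x j

^-^-factor : ∀ b x j → x ^ j - b ^ j ≡ (x - b) * geometricSum b x j
^-^-factor b x zero    = sym (ℤP.*-zeroʳ (x - b))
^-^-factor b x (suc j) = begin
  x * x ^ j - b * b ^ j                           ≡⟨ split x b (x ^ j) (b ^ j) ⟩
  (x - b) * x ^ j + b * (x ^ j - b ^ j)           ≡⟨ cong (λ r → (x - b) * x ^ j + b * r) (^-^-factor b x j) ⟩
  (x - b) * x ^ j + b * ((x - b) * geometricSum b x j) ≡⟨ merge x b (x ^ j) (geometricSum b x j) ⟩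
  (x - b) * (x ^ j + b * geometricSum b x j)      ∎
  where
  open ≡-Reasoning
  split : ∀ x b X B → x * X - b * B ≡ (x - b) * X + b * (X - B)
  split = solve-∀
  merge : ∀ x b X G → (x - b) * X + b * ((x - b) * G) ≡ (x - b) * (X + b * G)
  merge = solve-∀

rescale : (ℤ → ℤ) → Weighting → Weighting
rescale q = map (λ p → proj₁ p , proj₂ p * q (proj₁ p))

∫-rescale : ∀ W q f → ∫ (rescale q W) f ≡ ∫ W (λ x → q x * f x)
∫-rescale []            q f = refl
∫-rescale ((x , w) ∷ W) q f = cong₂ _+_ (ℤP.*-assoc w (q x) (f x)) (∫-rescale W q f)

extend : ℤ → (ℤ → ℤ) → Weighting → Weighting
extend b q W = (b , - ∫ W q) ∷ rescale q W

∫-extend : ∀ b q W f → ∫ (extend b q W) f ≡ ∫ W (λ x → q x * (f x - f b))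
∫-extend b q W f = begin
  - ∫ W q * f b + ∫ (rescale q W) f              ≡⟨ cong (_+_ (- ∫ W q * f b)) (∫-rescale W q f) ⟩
  - ∫ W q * f b + ∫ W (λ x → q x * f x)       ≡⟨ reorder (∫ W q) (f b) _ ⟩
  ∫ W (λ x → q x * f x) + (- f b) * ∫ W q     ≡⟨ cong (_+_ (∫ W (λ x → q x * f x))) (∫-*ˡ W (- f b) q) ⟨
  ∫ W (λ x → q x * f x) + ∫ W (λ x → (- f b) * q x) ≡⟨ ∫-+ W (λ x → q x * f x) (λ x → (- f b) * q x) ⟨
  ∫ W (λ x → q x * f x + (- f b) * q x)       ≡⟨ ∫-cong W (λ x → distrib (q x) (f x) (f b)) ⟩
  ∫ W (λ x → q x * (f x - f b))               ∎
  where
  open ≡-Reasoning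
  reorder : ∀ Q c P → - Q * c + P ≡ P + (- c) * Q
  reorder = solve-∀
  distrib : ∀ q a c → q * a + (- c) * q ≡ q * (a - c)
  distrib = solve-∀

extend-supported : ∀ {S} b q W → SupportedOn S W → SupportedOn (b ∷ S) (extend b q W)
extend-supported b q W sW = here refl ∷ go W sW
  where
  go : ∀ {S} W → SupportedOn S W → SupportedOn (b ∷ S) (rescale q W)
  go []      []         = []
  go (_ ∷ W) (x∈S ∷ sW) = there x∈S ∷ go W sW

record MomentWeighting (S : List ℤ) (t : ℕ) : Set where
  field
    weighting       : Weighting
    supported       : SupportedOn S weighting
    moment-vanishes : ∀ j → j < t → moment weighting j ≡ 0ℤ
    moment-nonzero  : moment weighting t ≢ 0ℤ

momentWeighting : ∀ t S → Unique S → length S ≡ suc t → MomentWeighting S t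
momentWeighting zero    (b ∷ [])    _ _ = record
  { weighting       = (b , 1ℤ) ∷ []
  ; supported       = here refl ∷ []
  ; moment-vanishes = λ _ ()
  ; moment-nonzero  = λ ()
  }
momentWeighting (suc t) (b ∷ S) (b∉S ∷ uniqS) len = record
  { weighting       = extend b q W
  ; supported       = extend-supported b q W (MomentWeighting.supported IH)
  ; moment-vanishes = λ { j (ℕ.s≤s j≤t) →
      trans (moment-extend j) (trans (cong (K *_) (G-vanishes j j≤t)) (ℤP.*-zeroʳ K)) }
  ; moment-nonzero  = λ eq → [ shiftedProduct-nonzero b S b∉S , moment-nonzero ∘ trans (sym G-top) ]′
      (ℤP.i*j≡0⇒i≡0∨j≡0 K (trans (sym (moment-extend (suc t))) eq))
  }
  where
  -- The divided-difference recursion without denominators: q x (x - b) = K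
  -- on S, so the new weighting is f ↦ K ∫ W (λ x → (f x - f b) / (x - b)).
  IH = momentWeighting t S uniqS (ℕP.suc-injective len)
  open MomentWeighting IH using (moment-vanishes; moment-nonzero) renaming (weighting to W)
  q : ℤ → ℤ
  q x = shiftedProductWithout b x S
  K = shiftedProduct b S
  G : ℕ → ℤ
  G j = ∫ W (λ x → geometricSum b x j)

  moment-extend : ∀ j → moment (extend b q W) j ≡ K * G j
  moment-extend j = begin
    moment (extend b q W) j                        ≡⟨ ∫-extend b q W (_^ j) ⟩
    ∫ W (λ x → q x * (x ^ j - b ^ j))              ≡⟨ ∫-cong W (λ x → cong (q x *_) (^-^-factor b x j)) ⟩
    ∫ W (λ x → q x * ((x - b) * geometricSum b x j)) ≡⟨ ∫-cong-supported W (MomentWeighting.supported IH) cancel ⟩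
    ∫ W (λ x → K * geometricSum b x j)             ≡⟨ ∫-*ˡ W K (λ x → geometricSum b x j) ⟩
    K * G j                                        ∎
    where
    open ≡-Reasoning
    cancel : ∀ {x} → x ∈ S → q x * ((x - b) * geometricSum b x j) ≡ K * geometricSum b x j
    cancel {x} x∈S = trans (sym (ℤP.*-assoc (q x) (x - b) _))
                           (cong (_* geometricSum b x j) (shiftedProductWithout-* b S x∈S))

  G-suc : ∀ j → G (suc j) ≡ moment W j + b * G j
  G-suc j = trans (∫-+ W (_^ j) (λ x → b * geometricSum b x j))
                  (cong (_+_ (moment W j)) (∫-*ˡ W b (λ x → geometricSum b x j)))

  G-vanishes : ∀ j → j ≤ t → G j ≡ 0ℤ
  G-vanishes zero    _   = ∫-zero W
  G-vanishes (suc j) j<t = begin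
    G (suc j)              ≡⟨ G-suc j ⟩
    moment W j + b * G j   ≡⟨ cong₂ (λ m g → m + b * g) (moment-vanishes j j<t) (G-vanishes j (ℕP.<⇒≤ j<t)) ⟩
    0ℤ + b * 0ℤ            ≡⟨ cong (_+_ 0ℤ) (ℤP.*-zeroʳ b) ⟩
    0ℤ                     ∎
    where open ≡-Reasoning

  G-top : G (suc t) ≡ moment W t
  G-top = begin
    G (suc t)              ≡⟨ G-suc t ⟩
    moment W t + b * G t   ≡⟨ cong (λ g → moment W t + b * g) (G-vanishes t ℕP.≤-refl) ⟩
    moment W t + b * 0ℤ    ≡⟨ cong (_+_ (moment W t)) (ℤP.*-zeroʳ b) ⟩
    moment W t + 0ℤ        ≡⟨ ℤP.+-identityʳ _ ⟩
    moment W t             ∎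
    where open ≡-Reasoning

-- Grids and products of linear forms

InGrid : ∀ {n} → (Fin n → List ℤ) → Vec ℤ n → Set
InGrid S z = ∀ w → lookup z w ∈ S w

gridAny? : ∀ n (S : Fin n → List ℤ) {P : Vec ℤ n → Set} → Decidable P → Dec (∃[ z ] InGrid S z × P z)
gridAny? zero    S P? with P? []
... | yes p  = yes ([] , (λ ()) , p)
... | no  ¬p = no (λ { ([] , _ , p) → ¬p p })
gridAny? (suc n) S {P} P? = map′ fromColumn toColumn (any? column? (S zero))
  where
  Column : ℤ → Set
  Column x = ∃[ z ] InGrid (S ∘ suc) z × P (x ∷ z)
  column? : Decidable Column
  column? x = gridAny? n (S ∘ suc) (P? ∘ (x ∷_))
  fromColumn : Any Column (S zero) → ∃[ z ] InGrid S z × P z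
  fromColumn any with find any
  ... | x , x∈ , z , z∈ , p = x ∷ z , (λ { zero → x∈ ; (suc w) → z∈ w }) , p
  toColumn : ∃[ z ] InGrid S z × P z → Any Column (S zero)
  toColumn (x ∷ z , x∷z∈ , p) = lose (x∷z∈ zero) (z , x∷z∈ ∘ suc , p)

∫ⁿ : ∀ n → (Fin n → Weighting) → (Vec ℤ n → ℤ) → ℤ
∫ⁿ zero    W g = g []
∫ⁿ (suc n) W g = ∫ (W zero) (λ x → ∫ⁿ n (W ∘ suc) (g ∘ (x ∷_)))

∫ⁿ-cong : ∀ n W {g h : Vec ℤ n → ℤ} → (∀ z → g z ≡ h z) → ∫ⁿ n W g ≡ ∫ⁿ n W h
∫ⁿ-cong zero    W g≗h = g≗h []
∫ⁿ-cong (suc n) W g≗h = ∫-cong (W zero) (λ x → ∫ⁿ-cong n (W ∘ suc) (g≗h ∘ (x ∷_)))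

∫ⁿ-zero : ∀ n W → ∫ⁿ n W (λ _ → 0ℤ) ≡ 0ℤ
∫ⁿ-zero zero    W = refl
∫ⁿ-zero (suc n) W = trans (∫-cong (W zero) (λ x → ∫ⁿ-zero n (W ∘ suc))) (∫-zero (W zero))

∫ⁿ-+ : ∀ n W (g h : Vec ℤ n → ℤ) → ∫ⁿ n W (λ z → g z + h z) ≡ ∫ⁿ n W g + ∫ⁿ n W h
∫ⁿ-+ zero    W g h = refl
∫ⁿ-+ (suc n) W g h =
  trans (∫-cong (W zero) (λ x → ∫ⁿ-+ n (W ∘ suc) (g ∘ (x ∷_)) (h ∘ (x ∷_)))) (∫-+ (W zero) _ _)

∫ⁿ-*ˡ : ∀ n W c (g : Vec ℤ n → ℤ) → ∫ⁿ n W (λ z → c * g z) ≡ c * ∫ⁿ n W g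
∫ⁿ-*ˡ zero    W c g = refl
∫ⁿ-*ˡ (suc n) W c g =
  trans (∫-cong (W zero) (λ x → ∫ⁿ-*ˡ n (W ∘ suc) c (g ∘ (x ∷_)))) (∫-*ˡ (W zero) c _)

∫ⁿ-∑ : ∀ n W {k} (g : Fin k → Vec ℤ n → ℤ) → ∫ⁿ n W (λ z → ∑ (λ i → g i z)) ≡ ∑ (λ i → ∫ⁿ n W (g i))
∫ⁿ-∑ n W {zero}  g = ∫ⁿ-zero n W
∫ⁿ-∑ n W {suc k} g =
  trans (∫ⁿ-+ n W (g zero) _) (cong (_+_ (∫ⁿ n W (g zero))) (∫ⁿ-∑ n W (g ∘ suc)))

∫ⁿ-∑ⱽ : ∀ n W k (g : Vec (Fin n) k → Vec ℤ n → ℤ) →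
        ∫ⁿ n W (λ z → ∑ⱽ k (λ φ → g φ z)) ≡ ∑ⱽ k (λ φ → ∫ⁿ n W (g φ))
∫ⁿ-∑ⱽ n W zero    g = refl
∫ⁿ-∑ⱽ n W (suc k) g = trans (∫ⁿ-∑ n W (λ w z → ∑ⱽ k (λ φ → g (w ∷ φ) z)))
                            (sum-cong-≗ (λ w → ∫ⁿ-∑ⱽ n W k (g ∘ (w ∷_))))

∫ⁿ-∏ : ∀ n W (h : Fin n → ℤ → ℤ) → ∫ⁿ n W (λ z → ∏ (λ w → h w (lookup z w))) ≡ ∏ (λ w → ∫ (W w) (h w))
∫ⁿ-∏ zero    W h = refl
∫ⁿ-∏ (suc n) W h = trans
  (∫-cong (W zero) (λ x → trans (∫ⁿ-*ˡ n (W ∘ suc) (h zero x) _) (cong (h zero x *_) (∫ⁿ-∏ n (W ∘ suc) (h ∘ suc)))))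
  (∫-*ʳ (W zero) _ (h zero))

∫ⁿ-vanishing : ∀ n W (S : Fin n → List ℤ) (g : Vec ℤ n → ℤ) → (∀ w → SupportedOn (S w) (W w)) →
               (∀ z → InGrid S z → g z ≡ 0ℤ) → ∫ⁿ n W g ≡ 0ℤ
∫ⁿ-vanishing zero    W S g sW g≡0 = g≡0 [] (λ ())
∫ⁿ-vanishing (suc n) W S g sW g≡0 = trans
  (∫-cong-supported (W zero) (sW zero) (λ x∈ →
    ∫ⁿ-vanishing n (W ∘ suc) (S ∘ suc) _ (sW ∘ suc) (λ z z∈ → g≡0 _ (λ { zero → x∈ ; (suc w) → z∈ w }))))
  (∫-zero (W zero))

record TailedForm (n : ℕ) : Set where
  field
    tail  : Fin n
    coeff : Fin n → ℤ
open TailedForm public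

⟦_⟧ : ∀ {n} → (Fin n → ℤ) → Vec ℤ n → ℤ
⟦ a ⟧ z = ∑ (λ w → a w * lookup z w)

∏⟦_⟧ : ∀ {n} → List (TailedForm n) → Vec ℤ n → ℤ
∏⟦ []     ⟧ z = 1ℤ
∏⟦ F ∷ Fs ⟧ z = ⟦ coeff F ⟧ z * ∏⟦ Fs ⟧ z

∏⟦⟧≢0⇒All≢0 : ∀ {n} (Fs : List (TailedForm n)) z → ∏⟦ Fs ⟧ z ≢ 0ℤ → All (λ F → ⟦ coeff F ⟧ z ≢ 0ℤ) Fs
∏⟦⟧≢0⇒All≢0 []       z _  = []
∏⟦⟧≢0⇒All≢0 (F ∷ Fs) z ≢0 =
  (λ eq → ≢0 (cong (_* ∏⟦ Fs ⟧ z) eq)) ∷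
  ∏⟦⟧≢0⇒All≢0 Fs z (λ eq → ≢0 (trans (cong (⟦ coeff F ⟧ z *_) eq) (ℤP.*-zeroʳ (⟦ coeff F ⟧ z))))

tails : ∀ {n} (Fs : List (TailedForm n)) → Vec (Fin n) (length Fs)
tails []       = []
tails (F ∷ Fs) = tail F ∷ tails Fs

-- A choice φ picks the variable φ_i from the i-th form; expanding the product
-- of the forms sums over all choices.
choiceCoeff : ∀ {n} (Fs : List (TailedForm n)) → Vec (Fin n) (length Fs) → ℤ
choiceCoeff []       []      = 1ℤ
choiceCoeff (F ∷ Fs) (w ∷ φ) = coeff F w * choiceCoeff Fs φ

monomial : ∀ {n k} → Vec (Fin n) k → Vec ℤ n → ℤ
monomial []      z = 1ℤ
monomial (w ∷ φ) z = lookup z w * monomial φ z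

exponent : ∀ {n k} → Vec (Fin n) k → Fin n → ℕ
exponent φ w = count (w ≟_) φ

tailCount : ∀ {n} → List (TailedForm n) → Fin n → ℕ
tailCount []       w = 0
tailCount (F ∷ Fs) w = if does (w ≟ tail F) then suc (tailCount Fs w) else tailCount Fs w

exponent-tails : ∀ {n} (Fs : List (TailedForm n)) w → exponent (tails Fs) w ≡ tailCount Fs w
exponent-tails []       w = refl
exponent-tails (F ∷ Fs) w with does (w ≟ tail F)
... | true  = cong suc (exponent-tails Fs w)
... | false = exponent-tails Fs w

tailCount-++ : ∀ {n} (Fs Gs : List (TailedForm n)) w → tailCount (Fs ++ Gs) w ≡ tailCount Fs w ℕ.+ tailCount Gs w
tailCount-++ []       Gs w = refl
tailCount-++ (F ∷ Fs) Gs w with does (w ≟ tail F)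
... | true  = cong suc (tailCount-++ Fs Gs w)
... | false = tailCount-++ Fs Gs w

tailCount-concatMap : ∀ {a n} {A : Set a} (g : A → List (TailedForm n)) xs w →
                      tailCount (concatMap g xs) w ≡ sum (map (λ x → tailCount (g x) w) xs)
tailCount-concatMap g []       w = refl
tailCount-concatMap g (x ∷ xs) w =
  trans (tailCount-++ (g x) (concatMap g xs) w) (cong (tailCount (g x) w ℕ.+_) (tailCount-concatMap g xs w))

tailCount-single : ∀ {n} u (Fs : List (TailedForm n)) w → All (λ F → tail F ≡ u) Fs →
                   tailCount Fs w ≡ (if does (w ≟ u) then length Fs else 0)
tailCount-single u []       w [] with does (w ≟ u)
... | true  = refl
... | false = refl
tailCount-single _ (F ∷ Fs) w (refl ∷ tails≡) with does (w ≟ tail F) | tailCount-single (tail F) Fs w tails≡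
... | true  | ih = cong suc ih
... | false | ih = ih

∏⟦⟧-expand : ∀ {n} (Fs : List (TailedForm n)) z →
             ∏⟦ Fs ⟧ z ≡ ∑ⱽ (length Fs) (λ φ → choiceCoeff Fs φ * monomial φ z)
∏⟦⟧-expand []       z = refl
∏⟦⟧-expand (F ∷ Fs) z = begin
  ⟦ coeff F ⟧ z * ∏⟦ Fs ⟧ z
    ≡⟨ cong (⟦ coeff F ⟧ z *_) (∏⟦⟧-expand Fs z) ⟩
  ⟦ coeff F ⟧ z * ∑ⱽ m (λ φ → choiceCoeff Fs φ * monomial φ z)
    ≡⟨ *-distribʳ-sum _ (λ w → coeff F w * lookup z w) ⟩
  ∑ (λ w → coeff F w * lookup z w * ∑ⱽ m (λ φ → choiceCoeff Fs φ * monomial φ z))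
    ≡⟨ sum-cong-≗ (λ w → trans (*-distribˡ-∑ⱽ m (coeff F w * lookup z w) (λ φ → choiceCoeff Fs φ * monomial φ z))
         (∑ⱽ-cong m (λ φ → swap (coeff F w) (lookup z w) (choiceCoeff Fs φ) (monomial φ z)))) ⟩
  ∑ (λ w → ∑ⱽ m (λ φ → coeff F w * choiceCoeff Fs φ * (lookup z w * monomial φ z)))
    ∎
  where
  open ≡-Reasoning
  m = length Fs
  swap : ∀ a b c d → a * b * (c * d) ≡ a * c * (b * d)
  swap = solve-∀

exponent-∷ : ∀ {n k} x (φ : Vec (Fin n) k) w →
             exponent (x ∷ φ) w ≡ (if does (w ≟ x) then 1 else 0) ℕ.+ exponent φ w
exponent-∷ x φ w with does (w ≟ x)
... | true  = refl
... | false = refl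

exponent-head : ∀ {n k} x (φ : Vec (Fin n) k) → 0 < exponent (x ∷ φ) x
exponent-head x φ with x ≟ x
... | yes _   = ℕ.s≤s ℕ.z≤n
... | no  x≢x = ⊥-elim (x≢x refl)

exponent-≤-∷ : ∀ {n k} x (φ : Vec (Fin n) k) w → exponent φ w ≤ exponent (x ∷ φ) w
exponent-≤-∷ x φ w rewrite exponent-∷ x φ w = ℕP.m≤n+m _ _

∑-exponent : ∀ {n k} (φ : Vec (Fin n) k) → ∑ℕ (exponent φ) ≡ k
∑-exponent {n} []      = ∑ℕ-zero n
∑-exponent     (x ∷ φ) = begin
  ∑ℕ (exponent (x ∷ φ))                      ≡⟨ ∑ℕ-cong (exponent-∷ x φ) ⟩
  ∑ℕ (λ w → δ w ℕ.+ exponent φ w)            ≡⟨ ∑ℕ-distrib-+ δ (exponent φ) ⟩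
  ∑ℕ δ ℕ.+ ∑ℕ (exponent φ)                   ≡⟨ cong₂ ℕ._+_ (sum-δ ℕP.+-0-monoid x (λ _ → 1)) (∑-exponent φ) ⟩
  suc _                                      ∎
  where
  open ≡-Reasoning
  δ : Fin _ → ℕ
  δ w = if does (w ≟ x) then 1 else 0

monomial-regroup : ∀ {n k} (φ : Vec (Fin n) k) z → monomial φ z ≡ ∏ (λ w → lookup z w ^ exponent φ w)
monomial-regroup {n} []      z = sym (∏-ones n)
monomial-regroup     (x ∷ φ) z = begin
  lookup z x * monomial φ z         ≡⟨ cong (lookup z x *_) (monomial-regroup φ z) ⟩
  lookup z x * ∏ zᵉ                  ≡⟨ cong (_* ∏ zᵉ) (sum-δ ℤP.*-1-monoid x (lookup z)) ⟨
  ∏ δz * ∏ zᵉ                        ≡⟨ ∏-distrib-* δz zᵉ ⟨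
  ∏ (λ w → δz w * zᵉ w)              ≡⟨ ∏-cong pointwise ⟩
  ∏ (λ w → lookup z w ^ exponent (x ∷ φ) w) ∎
  where
  open ≡-Reasoning
  zᵉ δz : Fin _ → ℤ
  zᵉ w = lookup z w ^ exponent φ w
  δz w = if does (w ≟ x) then lookup z w else 1ℤ
  pointwise : ∀ w → δz w * zᵉ w ≡ lookup z w ^ exponent (x ∷ φ) w
  pointwise w with does (w ≟ x)
  ... | true  = refl
  ... | false = ℤP.*-identityˡ _

*-preserves-0≤ : ∀ {i j} → 0ℤ ℤ.≤ i → 0ℤ ℤ.≤ j → 0ℤ ℤ.≤ i * j
*-preserves-0≤ {+ a} {+ b} _ _ = subst (0ℤ ℤ.≤_) (ℤP.pos-* a b) (ℤ.+≤+ ℕ.z≤n)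

*-preserves-0< : ∀ {i j} → 0ℤ ℤ.< i → 0ℤ ℤ.< j → 0ℤ ℤ.< i * j
*-preserves-0< (ℤ.+<+ (ℕ.s≤s {n = a} _)) (ℤ.+<+ (ℕ.s≤s {n = b} _)) = subst (0ℤ ℤ.<_) (ℤP.pos-* (suc a) (suc b)) (ℤ.+<+ (ℕ.s≤s ℕ.z≤n))

choiceCoeff-nonneg : ∀ {n} (V : Fin n → Set) (Fs : List (TailedForm n)) φ →
  All (λ F → ∀ w → V w → 0ℤ ℤ.≤ coeff F w) Fs → (∀ w → 0 < exponent φ w → V w) → 0ℤ ℤ.≤ choiceCoeff Fs φ
choiceCoeff-nonneg V []       []      _          _   = ℤ.+≤+ ℕ.z≤n
choiceCoeff-nonneg V (F ∷ Fs) (x ∷ φ) (F≥0 ∷ Fs≥0) φ∈V = *-preserves-0≤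
  (F≥0 x (φ∈V x (exponent-head x φ)))
  (choiceCoeff-nonneg V Fs φ Fs≥0 (λ w 0<e → φ∈V w (ℕP.<-≤-trans 0<e (exponent-≤-∷ x φ w))))

choiceCoeff-tails-pos : ∀ {n} (Fs : List (TailedForm n)) →
  All (λ F → 0ℤ ℤ.< coeff F (tail F)) Fs → 0ℤ ℤ.< choiceCoeff Fs (tails Fs)
choiceCoeff-tails-pos []       []              = ℤ.+<+ (ℕ.s≤s ℕ.z≤n)
choiceCoeff-tails-pos (F ∷ Fs) (F>0 ∷ Fs>0) = *-preserves-0< F>0 (choiceCoeff-tails-pos Fs Fs>0)

-- Combinatorial Nullstellensatz for a product of linear forms: integrating
-- against the product of the moment weightings extracts (up to the factor Λ)
-- the coefficient of ∏_w z_w^(deg w), a sum of nonnegative terms of which the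
-- one choosing every form's own tail is positive.
module _ {n} (Fs : List (TailedForm n)) (S : Fin n → List ℤ)
  (S-unique      : ∀ w → Unique (S w))
  (S-length      : ∀ w → length (S w) ≡ suc (tailCount Fs w))
  (coeff-nonneg  : All (λ F → ∀ w → 0 < tailCount Fs w → 0ℤ ℤ.≤ coeff F w) Fs)
  (coeff-tail-pos : All (λ F → 0ℤ ℤ.< coeff F (tail F)) Fs)
  where

  private
    deg : Fin n → ℕ
    deg = tailCount Fs
    m = length Fs
    MW : ∀ w → MomentWeighting (S w) (deg w)
    MW w = momentWeighting (deg w) (S w) (S-unique w) (S-length w)
    W : Fin n → Weighting
    W w = MomentWeighting.weighting (MW w)
    Λ : ℤ
    Λ = ∏ (λ w → moment (W w) (deg w))
    Λ≢0 : Λ ≢ 0ℤ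
    Λ≢0 = ∏-nonzero _ (λ w → MomentWeighting.moment-nonzero (MW w))
    moments-at-deg : (φ : Vec (Fin n) m) → (∀ w → exponent φ w ≡ deg w) →
                   ∏ (λ w → moment (W w) (exponent φ w)) ≡ Λ
    moments-at-deg φ φ≗deg = ∏-cong (λ w → cong (moment (W w)) (φ≗deg w))

  ∫ⁿ-monomial : ∀ {k} (φ : Vec (Fin n) k) → ∫ⁿ n W (monomial φ) ≡ ∏ (λ w → moment (W w) (exponent φ w))
  ∫ⁿ-monomial φ = trans (∫ⁿ-cong n W (monomial-regroup φ)) (∫ⁿ-∏ n W (λ w x → x ^ exponent φ w))

  -- Only choices with exponent vector exactly deg survive, since ∑ deg = m.
  moments-vanish-or-match : (φ : Vec (Fin n) m) →
    (∀ w → exponent φ w ≡ deg w) ⊎ ∏ (λ w → moment (W w) (exponent φ w)) ≡ 0ℤ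
  moments-vanish-or-match φ with FinP.any? (λ w → exponent φ w ℕP.<? deg w)
  ... | yes (w , e<deg) = inj₂ (∏-zero _ w (MomentWeighting.moment-vanishes (MW w) _ e<deg))
  ... | no  ¬e<deg      = inj₁ (λ w → sym (∑ℕ-≡⇒≗ deg≤e ∑deg≡∑e w))
    where
    deg≤e : ∀ w → deg w ≤ exponent φ w
    deg≤e w = ℕP.≮⇒≥ (λ e<deg → ¬e<deg (w , e<deg))
    ∑deg≡∑e : ∑ℕ deg ≡ ∑ℕ (exponent φ)
    ∑deg≡∑e = begin
      ∑ℕ deg                    ≡⟨ ∑ℕ-cong (λ w → exponent-tails Fs w) ⟨
      ∑ℕ (exponent (tails Fs))  ≡⟨ ∑-exponent (tails Fs) ⟩
      m                         ≡⟨ ∑-exponent φ ⟨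
      ∑ℕ (exponent φ)           ∎
      where open ≡-Reasoning

  choiceTerm-multiple : (φ : Vec (Fin n) m) → Σ ℕ λ k →
    choiceCoeff Fs φ * ∏ (λ w → moment (W w) (exponent φ w)) ≡ Λ * + k ×
    ((∀ w → exponent φ w ≡ deg w) → choiceCoeff Fs φ ≡ + k)
  choiceTerm-multiple φ with moments-vanish-or-match φ
  ... | inj₂ ≡0  = 0
    , trans (cong (choiceCoeff Fs φ *_) ≡0) (trans (ℤP.*-zeroʳ (choiceCoeff Fs φ)) (sym (ℤP.*-zeroʳ Λ)))
    , λ φ≗deg → ⊥-elim (Λ≢0 (trans (sym (moments-at-deg φ φ≗deg)) ≡0))
  ... | inj₁ φ≗deg = ∣ c ∣ , (begin
      c * ∏ (λ w → moment (W w) (exponent φ w)) ≡⟨ cong₂ _*_ c≡∣c∣ (moments-at-deg φ φ≗deg) ⟩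
      + ∣ c ∣ * Λ                               ≡⟨ ℤP.*-comm (+ ∣ c ∣) Λ ⟩
      Λ * + ∣ c ∣                               ∎) , λ _ → c≡∣c∣
    where
    open ≡-Reasoning
    c = choiceCoeff Fs φ
    c≡∣c∣ : c ≡ + ∣ c ∣
    c≡∣c∣ = sym (ℤP.0≤i⇒+∣i∣≡i (choiceCoeff-nonneg (λ w → 0 < deg w) Fs φ coeff-nonneg
                                  (λ w 0<e → subst (0 <_) (φ≗deg w) 0<e)))

  private
    termWeight : Vec (Fin n) m → ℕ
    termWeight φ = proj₁ (choiceTerm-multiple φ)

  ∫ⁿ-∏⟦⟧ : ∫ⁿ n W ∏⟦ Fs ⟧ ≡ Λ * + ∑ⱽℕ m termWeight
  ∫ⁿ-∏⟦⟧ = begin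
    ∫ⁿ n W ∏⟦ Fs ⟧
      ≡⟨ ∫ⁿ-cong n W (∏⟦⟧-expand Fs) ⟩
    ∫ⁿ n W (λ z → ∑ⱽ m (λ φ → choiceCoeff Fs φ * monomial φ z))
      ≡⟨ ∫ⁿ-∑ⱽ n W m (λ φ z → choiceCoeff Fs φ * monomial φ z) ⟩
    ∑ⱽ m (λ φ → ∫ⁿ n W (λ z → choiceCoeff Fs φ * monomial φ z))
      ≡⟨ ∑ⱽ-cong m (λ φ → trans (∫ⁿ-*ˡ n W (choiceCoeff Fs φ) (monomial φ))
                               (cong (choiceCoeff Fs φ *_) (∫ⁿ-monomial φ))) ⟩
    ∑ⱽ m (λ φ → choiceCoeff Fs φ * ∏ (λ w → moment (W w) (exponent φ w)))
      ≡⟨ ∑ⱽ-cong m (λ φ → proj₁ (proj₂ (choiceTerm-multiple φ))) ⟩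
    ∑ⱽ m (λ φ → Λ * + termWeight φ)
      ≡⟨ *-distribˡ-∑ⱽ m Λ (λ φ → + termWeight φ) ⟨
    Λ * ∑ⱽ m (λ φ → + termWeight φ)
      ≡⟨ cong (Λ *_) (∑ⱽ-pos m termWeight) ⟩
    Λ * + ∑ⱽℕ m termWeight
      ∎
    where open ≡-Reasoning

  termWeight-tails-pos : 0 < termWeight (tails Fs)
  termWeight-tails-pos with choiceCoeff-tails-pos Fs coeff-tail-pos
  ... | 0<c rewrite proj₂ (proj₂ (choiceTerm-multiple (tails Fs))) (exponent-tails Fs) with 0<c
  ...   | ℤ.+<+ 0<weight = 0<weight

  ∫ⁿ-∏⟦⟧-nonzero : ∫ⁿ n W ∏⟦ Fs ⟧ ≢ 0ℤ
  ∫ⁿ-∏⟦⟧-nonzero eq with ℤP.i*j≡0⇒i≡0∨j≡0 Λ (trans (sym ∫ⁿ-∏⟦⟧) eq)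
  ... | inj₁ Λ≡0 = Λ≢0 Λ≡0
  ... | inj₂ ∑≡0 = ℕP.<⇒≢ (ℕP.<-≤-trans termWeight-tails-pos (≤-∑ⱽℕ m termWeight (tails Fs)))
                         (sym (ℤP.+-injective ∑≡0))

  nonvanishingPoint : ∃[ z ] InGrid S z × All (λ F → ⟦ coeff F ⟧ z ≢ 0ℤ) Fs
  nonvanishingPoint with gridAny? n S (λ z → ¬? (∏⟦ Fs ⟧ z ℤP.≟ 0ℤ))
  ... | yes (z , z∈S , ≢0) = z , z∈S , ∏⟦⟧≢0⇒All≢0 Fs z ≢0
  ... | no  none           = ⊥-elim (∫ⁿ-∏⟦⟧-nonzero (∫ⁿ-vanishing n W S ∏⟦ Fs ⟧
      (λ w → MomentWeighting.supported (MW w))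
      (λ z z∈S → decidable-stable (∏⟦ Fs ⟧ z ℤP.≟ 0ℤ) (λ ≢0 → none (z , z∈S , ≢0)))))

-- Odd closed walks and 2-colourings

ProperColouring : ∀ {n} → Graph n → (Fin n → Set) → (Fin n → Bool) → Set
ProperColouring G H colour = ∀ u v → H u → H v → T (adj G u v) → colour v ≡ not (colour u)

parity : ℕ → Bool
parity zero          = false
parity (suc zero)    = true
parity (suc (suc k)) = parity k

parity-suc : ∀ k → parity (suc k) ≡ not (parity k)
parity-suc zero          = refl
parity-suc (suc zero)    = refl
parity-suc (suc (suc k)) = parity-suc k

parity-+ : ∀ a b → parity (a ℕ.+ b) ≡ parity a xor parity b
parity-+ zero          b = refl
parity-+ (suc zero)    b = parity-suc b
parity-+ (suc (suc a)) b = parity-+ a b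

parity-odd : ∀ k → parity k ≡ true → ∃[ j ] k ≡ suc (2 ℕ.* j)
parity-odd (suc zero)    _  = 0 , refl
parity-odd (suc (suc k)) eq with parity-odd k eq
... | j , refl = suc j , cong (suc ∘′ suc) (sym (ℕP.+-suc j (j ℕ.+ 0)))

module _ {A : Set} where

  length-split : ∀ (p : List A) x q r → length (p ++ x ∷ q ++ x ∷ r) ≡ length (x ∷ q) ℕ.+ length (x ∷ r ++ p)
  length-split p x q r = begin
    length (p ++ x ∷ q ++ x ∷ r)                      ≡⟨ ListP.length-++ p ⟩
    length p ℕ.+ suc (length (q ++ x ∷ r))            ≡⟨ cong (λ l → length p ℕ.+ suc l) (ListP.length-++ q) ⟩
    length p ℕ.+ suc (length q ℕ.+ suc (length r))    ≡⟨ rearrange (length p) (length q) (length r) ⟩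
    suc (length q) ℕ.+ suc (length r ℕ.+ length p)    ≡⟨ cong (λ l → suc (length q) ℕ.+ suc l) (ListP.length-++ r) ⟨
    suc (length q) ℕ.+ suc (length (r ++ p))          ∎
    where
    open ≡-Reasoning
    rearrange : ∀ P Q R → P ℕ.+ suc (Q ℕ.+ suc R) ≡ suc Q ℕ.+ suc (R ℕ.+ P)
    rearrange = ℕ-Solver.solve-∀

  length-split-left : ∀ (p : List A) x q r {b} → length (p ++ x ∷ q ++ x ∷ r) < suc b → length (x ∷ q) < b
  length-split-left p x q r xs<1+b = ℕP.<-≤-trans
    (subst (length (x ∷ q) <_) (sym (length-split p x q r)) (ℕP.m<m+n _ (ℕ.s≤s ℕ.z≤n))) (ℕ.s≤s⁻¹ xs<1+b)

  length-split-right : ∀ (p : List A) x q r {b} → length (p ++ x ∷ q ++ x ∷ r) < suc b → length (x ∷ r ++ p) < b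
  length-split-right p x q r xs<1+b = ℕP.<-≤-trans
    (subst (length (x ∷ r ++ p) <_) (sym (length-split p x q r)) (ℕP.m<n+m _ (ℕ.s≤s ℕ.z≤n))) (ℕ.s≤s⁻¹ xs<1+b)

  All-split : ∀ {P : A → Set} p x q r → All P (p ++ x ∷ q ++ x ∷ r) → All P (x ∷ q) × All P (x ∷ r ++ p)
  All-split p x q r all with AllP.++⁻ p all
  ... | Pp , Px ∷ rest with AllP.++⁻ q rest
  ...   | Pq , _ ∷ Pr = Px ∷ Pq , Px ∷ AllP.++⁺ Pr Pp

  unique-or-repeat : DecidableEquality A → ∀ (xs : List A) →
                     Unique xs ⊎ ∃[ x ] ∃[ p ] ∃[ q ] ∃[ r ] xs ≡ p ++ x ∷ q ++ x ∷ r
  unique-or-repeat _≟ᴬ_ [] = inj₁ []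
  unique-or-repeat _≟ᴬ_ (x ∷ xs) with any? (x ≟ᴬ_) xs
  ... | yes x∈xs = let q , r , eq = MemP.∈-∃++ x∈xs in inj₂ (x , [] , q , r , cong (x ∷_) eq)
  ... | no  x∉xs with unique-or-repeat _≟ᴬ_ xs
  ...   | inj₁ unique = inj₁ (AllP.¬Any⇒All¬ xs x∉xs ∷ unique)
  ...   | inj₂ (y , p , q , r , eq) = inj₂ (y , x ∷ p , q , r , cong (x ∷_) eq)

module _ {n} (G : Graph n) where

  adj-sym : ∀ {u v} → T (adj G u v) → T (adj G v u)
  adj-sym {u} {v} = subst T (Graph.sym G u v)

  adj-irrefl : ∀ {v} → ¬ T (adj G v v)
  adj-irrefl {v} = subst T (irrefl G v)

  ConsecAdj-split : ∀ xs y ys → ConsecAdj G (xs ++ y ∷ ys) → ConsecAdj G (xs ++ [ y ]) × ConsecAdj G (y ∷ ys)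
  ConsecAdj-split []            y ys h       = tt , h
  ConsecAdj-split (x ∷ [])      y ys (e , h) = (e , tt) , h
  ConsecAdj-split (x ∷ x′ ∷ xs) y ys (e , h) = let h₁ , h₂ = ConsecAdj-split (x′ ∷ xs) y ys h in (e , h₁) , h₂

  ConsecAdj-join : ∀ xs y ys → ConsecAdj G (xs ++ [ y ]) → ConsecAdj G (y ∷ ys) → ConsecAdj G (xs ++ y ∷ ys)
  ConsecAdj-join []            y ys h₁       h₂ = h₂
  ConsecAdj-join (x ∷ [])      y ys (e , _)  h₂ = e , h₂
  ConsecAdj-join (x ∷ x′ ∷ xs) y ys (e , h₁) h₂ = e , ConsecAdj-join (x′ ∷ xs) y ys h₁ h₂

  ClosedWalk : List (Fin n) → Set
  ClosedWalk []       = ⊥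
  ClosedWalk (x ∷ xs) = ConsecAdj G (x ∷ xs ++ [ x ])

  closedWalk-split : ∀ p a q r → ClosedWalk (p ++ a ∷ q ++ a ∷ r) → ClosedWalk (a ∷ q) × ClosedWalk (a ∷ r ++ p)
  closedWalk-split [] a q r h
    with ConsecAdj-split (a ∷ q) a (r ++ [ a ]) (subst (λ l → ConsecAdj G (a ∷ l)) (ListP.++-assoc q (a ∷ r) [ a ]) h)
  ... | h₁ , h₂ = h₁ , subst (λ l → ConsecAdj G (a ∷ l ++ [ a ])) (sym (ListP.++-identityʳ r)) h₂
  closedWalk-split (x ∷ p) a q r h
    with ConsecAdj-split (x ∷ p) a (q ++ a ∷ r ++ [ x ])
           (subst (λ l → ConsecAdj G (x ∷ l))
                  (trans (ListP.++-assoc p (a ∷ q ++ a ∷ r) [ x ]) (cong (λ l → p ++ a ∷ l) (ListP.++-assoc q (a ∷ r) [ x ]))) h)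
  ... | h₁ , h₂ with ConsecAdj-split (a ∷ q) a (r ++ [ x ]) h₂
  ...   | h₃ , h₄ = h₃ , subst (λ l → ConsecAdj G (a ∷ l)) (sym (ListP.++-assoc r (x ∷ p) [ a ]))
                                (ConsecAdj-join (a ∷ r) x (p ++ [ a ]) h₄ h₁)

  module _ {H : Fin n → Set} (odd-cycle-leaves-H : ∀ C → IsOddCycle G C → ¬ All H C) where

    oddCycle-leaves-H : ∀ xs → Unique xs → ClosedWalk xs → parity (length xs) ≡ true → ¬ All H xs
    oddCycle-leaves-H (x ∷ [])         _      (x~x , _) _   _    = adj-irrefl x~x
    oddCycle-leaves-H (x ∷ y ∷ [])     _      _         ()  _
    oddCycle-leaves-H (x ∷ y ∷ z ∷ zs) unique cw        odd xs∈H =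
      odd-cycle-leaves-H _ ((unique , ℕ.s≤s (ℕ.s≤s (ℕ.s≤s ℕ.z≤n)) , cw) , parity-odd _ odd) xs∈H

    -- An odd closed walk is an odd cycle or splits at a repeated vertex into
    -- two shorter closed walks, one of which is odd.
    oddClosedWalk-leaves-H : ∀ bound xs → length xs < bound → ClosedWalk xs →
                             parity (length xs) ≡ true → ¬ All H xs
    oddClosedWalk-leaves-H (suc b) xs xs<b cw odd xs∈H with unique-or-repeat _≟_ xs
    ... | inj₁ unique = oddCycle-leaves-H xs unique cw odd xs∈H
    ... | inj₂ (a , p , q , r , refl)
      with parity (length (a ∷ q)) in odd₁
    ... | true  = oddClosedWalk-leaves-H b (a ∷ q) (length-split-left p a q r xs<b) (proj₁ (closedWalk-split p a q r cw))
                    odd₁ (proj₁ (All-split p a q r xs∈H))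
    ... | false = oddClosedWalk-leaves-H b (a ∷ r ++ p) (length-split-right p a q r xs<b) (proj₂ (closedWalk-split p a q r cw))
                    (subst (λ c → c xor parity (length (a ∷ r ++ p)) ≡ true) odd₁ parities)
                    (proj₂ (All-split p a q r xs∈H))
      where
      parities : parity (length (a ∷ q)) xor parity (length (a ∷ r ++ p)) ≡ true
      parities = trans (sym (parity-+ (length (a ∷ q)) _)) (trans (cong parity (sym (length-split p a q r))) odd)

  module _ {H : Fin n → Set} (H? : Decidable H) (odd-cycle-leaves-H : ∀ C → IsOddCycle G C → ¬ All H C) where

    data Walk : Fin n → Fin n → Bool → Set where
      stay : ∀ {u} → H u → Walk u u false
      step : ∀ {u w v p} → H u → T (adj G u w) → Walk w v p → Walk u v (not p)

    start-H : ∀ {u v p} → Walk u v p → H u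
    start-H (stay h)     = h
    start-H (step h _ _) = h

    _++ʷ_ : ∀ {u v y p q} → Walk u v p → Walk v y q → Walk u y (p xor q)
    stay _                ++ʷ W′ = W′
    step {p = p} h e W ++ʷ W′ = subst (Walk _ _) (BoolP.not-distribˡ-xor p _) (step h e (W ++ʷ W′))

    reverse : ∀ {u v p} → Walk u v p → Walk v u p
    reverse (stay h)               = stay h
    reverse (step {p = p} h e W) =
      subst (Walk _ _) (trans (sym (BoolP.not-distribʳ-xor p false)) (cong not (BoolP.xor-identityʳ p)))
            (reverse W ++ʷ step (start-H W) (adj-sym e) (stay h))

    -- all vertices of the walk but the last
    vertices : ∀ {u v p} → Walk u v p → List (Fin n)
    vertices (stay _)             = []
    vertices (step {u = u} _ _ W) = u ∷ vertices W

    vertices-parity : ∀ {u v p} (W : Walk u v p) → parity (length (vertices W)) ≡ p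
    vertices-parity (stay _)     = refl
    vertices-parity (step _ _ W) = trans (parity-suc (length (vertices W))) (cong not (vertices-parity W))

    vertices-ConsecAdj : ∀ {u v p} (W : Walk u v p) → ConsecAdj G (vertices W ++ [ v ])
    vertices-ConsecAdj (stay _)                    = tt
    vertices-ConsecAdj (step _ e (stay _))         = e , tt
    vertices-ConsecAdj (step _ e W@(step _ _ _))   = e , vertices-ConsecAdj W

    vertices-H : ∀ {u v p} (W : Walk u v p) → All H (vertices W)
    vertices-H (stay _)     = []
    vertices-H (step h _ W) = h ∷ vertices-H W

    no-odd-closed-walk : ∀ {x p} → Walk x x p → p ≢ true
    no-odd-closed-walk (stay _)         ()
    no-odd-closed-walk W@(step _ _ _) odd =
      oddClosedWalk-leaves-H odd-cycle-leaves-H _ (vertices W) (ℕP.n<1+n _)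
        (vertices-ConsecAdj W) (trans (vertices-parity W) odd) (vertices-H W)

    -- A spanning forest of the H-vertices among the first i, each vertex
    -- coloured by the parity of a walk from the root of its tree.
    record Rooting (i : ℕ) : Set where
      field
        root   : Fin n → Fin n
        colour : Fin n → Bool
        walk   : ∀ v → H v → toℕ v < i → Walk (root v) v (colour v)
        rooted : ∀ u v → H u → H v → toℕ u < i → toℕ v < i → T (adj G u v) → root u ≡ root v

    rooting₀ : Rooting 0
    rooting₀ = record { root = λ v → v ; colour = λ _ → false ; walk = λ _ _ () ; rooted = λ _ _ _ _ () }

    module Extend {i} (x : Fin n) (x≡i : toℕ x ≡ i) (R : Rooting i) where
      open Rooting R

      below : ∀ {v} → toℕ v < suc i → v ≢ x → toℕ v < i
      below {v} v<1+i v≢x with ℕP.m≤n⇒m<n∨m≡n (ℕ.s≤s⁻¹ v<1+i)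
      ... | inj₁ v<i = v<i
      ... | inj₂ v≡i = ⊥-elim (v≢x (FinP.toℕ-injective (trans v≡i (sym x≡i))))

      skip : ¬ H x → Rooting (suc i)
      skip x∉H = record
        { root   = root
        ; colour = colour
        ; walk   = λ v v∈H v<1+i → walk v v∈H (below v<1+i (λ { refl → x∉H v∈H }))
        ; rooted = λ u v u∈H v∈H u< v< → rooted u v u∈H v∈H (below u< (λ { refl → x∉H u∈H }))
                                                             (below v< (λ { refl → x∉H v∈H }))
        }

      -- x becomes the root of every tree containing one of its neighbours.
      module Join (x∈H : H x) where
        Attached : Fin n → Set
        Attached a = (H a × toℕ a < i) × T (adj G x a)

        Joins : Fin n → Set
        Joins v = ∃[ a ] Attached a × root a ≡ root v

        joins? : Decidable Joins
        joins? v = FinP.any? (λ a → ((H? a ×-dec (toℕ a ℕP.<? i)) ×-dec T? (adj G x a)) ×-dec (root a ≟ root v))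

        root′ : Fin n → Fin n
        root′ v with v ≟ x | joins? v
        ... | yes _ | _     = x
        ... | no  _ | yes _ = x
        ... | no  _ | no  _ = root v

        colour′ : Fin n → Bool
        colour′ v with v ≟ x | joins? v
        ... | yes _ | _            = false
        ... | no  _ | yes (a , _)  = not (colour a xor colour v)
        ... | no  _ | no  _        = colour v

        walk′ : ∀ v → H v → toℕ v < suc i → Walk (root′ v) v (colour′ v)
        walk′ v v∈H v< with v ≟ x | joins? v
        ... | yes refl | _ = stay v∈H
        ... | no  v≢x  | yes (a , ((a∈H , a<i) , x~a) , ra≡rv) =
          step x∈H x~a (reverse (walk a a∈H a<i) ++ʷ subst (λ r → Walk r v (colour v)) (sym ra≡rv) (walk v v∈H (below v< v≢x)))
        ... | no  v≢x  | no  _ = walk v v∈H (below v< v≢x)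

        rooted′ : ∀ u v → H u → H v → toℕ u < suc i → toℕ v < suc i → T (adj G u v) → root′ u ≡ root′ v
        rooted′ u v u∈H v∈H u< v< u~v with u ≟ x | joins? u | v ≟ x | joins? v
        ... | yes refl | _      | yes refl | _      = ⊥-elim (adj-irrefl u~v)
        ... | yes _    | _      | no  _    | yes _  = refl
        ... | yes refl | _      | no  v≢x  | no ¬jv = ⊥-elim (¬jv (v , ((v∈H , below v< v≢x) , u~v) , refl))
        ... | no  _    | yes _  | yes _    | _      = refl
        ... | no  u≢x  | no ¬ju | yes refl | _      = ⊥-elim (¬ju (u , ((u∈H , below u< u≢x) , adj-sym u~v) , refl))
        ... | no  _    | yes _  | no  _    | yes _  = refl
        ... | no  u≢x  | yes (a , att , ra≡ru) | no v≢x | no ¬jv =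
          ⊥-elim (¬jv (a , att , trans ra≡ru (rooted u v u∈H v∈H (below u< u≢x) (below v< v≢x) u~v)))
        ... | no  u≢x  | no ¬ju | no v≢x | yes (b , att , rb≡rv) =
          ⊥-elim (¬ju (b , att , trans rb≡rv (sym (rooted u v u∈H v∈H (below u< u≢x) (below v< v≢x) u~v))))
        ... | no  u≢x  | no _   | no v≢x | no _ = rooted u v u∈H v∈H (below u< u≢x) (below v< v≢x) u~v

        rooting′ : Rooting (suc i)
        rooting′ = record { root = root′ ; colour = colour′ ; walk = walk′ ; rooted = rooted′ }

      extended : Rooting (suc i)
      extended with H? x
      ... | yes x∈H = Join.rooting′ x∈H
      ... | no  x∉H = skip x∉H

    rooting : ∀ i → i ≤ n → Rooting i
    rooting zero    _   = rooting₀
    rooting (suc i) i<n = Extend.extended (fromℕ< i<n) (FinP.toℕ-fromℕ< i<n) (rooting i (ℕP.<⇒≤ i<n))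

    properColouring : Σ (Fin n → Bool) (ProperColouring G H)
    properColouring = colour , proper
      where
      open Rooting (rooting n ℕP.≤-refl)
      below-n : ∀ v → toℕ v < n
      below-n = FinP.toℕ<n
      flipped : ∀ a b → a xor not b ≢ true → b ≡ not a
      flipped false false odd-free = ⊥-elim (odd-free refl)
      flipped false true  _        = refl
      flipped true  false _        = refl
      flipped true  true  odd-free = ⊥-elim (odd-free refl)
      -- Both walks start at the common root, so with the edge uv they form a
      -- closed walk of parity colour u xor not (colour v), which must be even.
      proper : ProperColouring G H colour
      proper u v u∈H v∈H u~v = flipped (colour u) (colour v) (no-odd-closed-walk
        (walk u u∈H (below-n u) ++ʷ step u∈H u~v (reverse (subst (λ r → Walk r v (colour v))
          (sym (rooted u v u∈H v∈H (below-n u) (below-n v) u~v)) (walk v v∈H (below-n v))))))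

-- The forms of an orientation

module _ {n} (G : Graph n) (D : Orientation G) where

  SimplicialSink : Fin n → Set
  SimplicialSink v = Simplicial G v × outdeg D v ≡ 0

  simplicialSink? : Decidable SimplicialSink
  simplicialSink? v =
    (FinP.all? λ u → FinP.all? λ w → T? (adj G v u) →-dec T? (adj G v w) →-dec ¬? (u ≟ w) →-dec T? (adj G u w))
    ×-dec (outdeg D v ℕP.≟ 0)

  outdeg-pos : ∀ {u v} → T (arc D u v) → 0 < outdeg D u
  outdeg-pos {u} {v} u→v = ℕP.<-≤-trans (1≤[arc] (arc D u v) u→v)
    (ℕP.≤-trans (≤-∑ℕ (λ w → [ arc D u w ]ᵇ) v) (ℕP.≤-reflexive (sym (sum-allFin (λ w → [ arc D u w ]ᵇ)))))
    where
    1≤[arc] : ∀ b → T b → 0 < [ b ]ᵇ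
    1≤[arc] true _ = ℕ.s≤s ℕ.z≤n

  outdeg-pos⇒¬SimplicialSink : ∀ {w} → 0 < outdeg D w → ¬ SimplicialSink w
  outdeg-pos⇒¬SimplicialSink 0<d (_ , d≡0) = ℕP.<⇒≢ 0<d (sym d≡0)

  outNeighbours : Fin n → List (Fin n)
  outNeighbours u = filter (T? ∘ arc D u) (allFin n)

  module ArcForms (colour : Fin n → Bool) where

    σ : Fin n → ℤ
    σ w = if colour w then 1ℤ else -1ℤ

    σ-σ : ∀ w → σ w * σ w ≡ 1ℤ
    σ-σ w with colour w
    ... | true  = refl
    ... | false = refl

    σ-agree : ∀ {a b} → colour b ≡ colour a → σ a * σ b ≡ 1ℤ
    σ-agree {a} eq = trans (cong (λ c → σ a * (if c then 1ℤ else -1ℤ)) eq) (σ-σ a)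

    σ-flip : ∀ {a b} → colour b ≡ not (colour a) → σ a * σ b ≡ -1ℤ
    σ-flip {a} {b} eq with colour a | colour b | eq
    ... | true  | false | _ = refl
    ... | false | true  | _ = refl

    arcForm : Fin n → Fin n → TailedForm n
    arcForm u v = record { tail = u ; coeff = λ w → σ u * σ w * (+ [ adj G v w ]ᵇ - + [ adj G u w ]ᵇ) }

    arcForms : Fin n → List (TailedForm n)
    arcForms u = map (arcForm u) (outNeighbours u)

    arcSystem : List (TailedForm n)
    arcSystem = concatMap arcForms (allFin n)

    tailCount-arcSystem : ∀ w → tailCount arcSystem w ≡ outdeg D w
    tailCount-arcSystem w = begin
      tailCount arcSystem w
        ≡⟨ tailCount-concatMap arcForms (allFin n) w ⟩
      sum (map (λ u → tailCount (arcForms u) w) (allFin n))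
        ≡⟨ sum-allFin (λ u → tailCount (arcForms u) w) ⟩
      ∑ℕ (λ u → tailCount (arcForms u) w)
        ≡⟨ ∑ℕ-cong (λ u → trans (tailCount-single u (arcForms u) w (AllP.map⁺ (All.universal (λ _ → refl) (outNeighbours u))))
                                (cong (λ b → if b then length (arcForms u) else 0) (does-≟-comm w u))) ⟩
      ∑ℕ (λ u → if does (u ≟ w) then length (arcForms u) else 0)
        ≡⟨ sum-δ ℕP.+-0-monoid w (λ u → length (arcForms u)) ⟩
      length (arcForms w)
        ≡⟨ ListP.length-map (arcForm w) (outNeighbours w) ⟩
      length (outNeighbours w)
        ≡⟨ length-filter-T (arc D w) (allFin n) ⟩
      outdeg D w
        ∎
      where open ≡-Reasoning

    arcSystem-complete : ∀ {u v} → T (arc D u v) → arcForm u v ∈ arcSystem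
    arcSystem-complete {u} {v} u→v = MemP.∈-concatMap⁺ arcForms
      (lose (MemP.∈-allFin u) (MemP.∈-map⁺ (arcForm u) (MemP.∈-filter⁺ (T? ∘ arc D u) (MemP.∈-allFin v) u→v)))

    arcSystem-sound : ∀ {F} → F ∈ arcSystem → ∃[ u ] ∃[ v ] T (arc D u v) × F ≡ arcForm u v
    arcSystem-sound F∈ with find (MemP.∈-concatMap⁻ arcForms {xs = allFin n} F∈)
    ... | u , _ , F∈arcForms with MemP.∈-map⁻ (arcForm u) F∈arcForms
    ...   | v , v∈out , refl = u , v , proj₂ (MemP.∈-filter⁻ (T? ∘ arc D u) {xs = allFin n} v∈out) , refl

    arcForm-tail-pos : ∀ {u v} → T (arc D u v) → 0ℤ ℤ.< coeff (arcForm u v) u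
    arcForm-tail-pos {u} {v} u→v
      rewrite Equivalence.to BoolP.T-≡ (adj-sym G (arc⇒adj D u v u→v)) | irrefl G u | σ-σ u = ℤ.+<+ (ℕ.s≤s ℕ.z≤n)

    module _ (proper : ProperColouring G (¬_ ∘ SimplicialSink) colour) where

      -- the only place where simpliciality is used
      σ-common-neighbour : ∀ {u v w} → T (arc D u v) → 0 < outdeg D w → T (adj G v w) → ¬ T (adj G u w) →
                           σ u * σ w ≡ 1ℤ
      σ-common-neighbour {u} {v} {w} u→v w-out v~w u≁w with w ≟ u
      ... | yes refl = σ-σ u
      ... | no  w≢u  = σ-agree (begin
        colour w             ≡⟨ proper v w v-ns w-ns v~w ⟩
        not (colour v)       ≡⟨ cong not (proper u v u-ns v-ns u~v) ⟩
        not (not (colour u)) ≡⟨ BoolP.not-involutive (colour u) ⟩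
        colour u             ∎)
        where
        open ≡-Reasoning
        u~v = arc⇒adj D u v u→v
        u-ns = outdeg-pos⇒¬SimplicialSink (outdeg-pos u→v)
        w-ns = outdeg-pos⇒¬SimplicialSink w-out
        v-ns : ¬ SimplicialSink v
        v-ns (simplicial , _) = u≁w (simplicial u w (adj-sym G u~v) v~w (w≢u ∘ sym))

      σ-adjacent : ∀ {u v w} → T (arc D u v) → 0 < outdeg D w → T (adj G u w) → σ u * σ w ≡ -1ℤ
      σ-adjacent {u} {v} {w} u→v w-out u~w =
        σ-flip (proper u w (outdeg-pos⇒¬SimplicialSink (outdeg-pos u→v)) (outdeg-pos⇒¬SimplicialSink w-out) u~w)

      arcForm-nonneg : ∀ {u v} → T (arc D u v) → ∀ w → 0 < outdeg D w → 0ℤ ℤ.≤ coeff (arcForm u v) w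
      arcForm-nonneg {u} {v} u→v w w-out with adj G v w in v~w | adj G u w in u~w
      ... | true  | true  = subst (0ℤ ℤ.≤_) (sym (ℤP.*-zeroʳ (σ u * σ w))) (ℤ.+≤+ ℕ.z≤n)
      ... | false | false = subst (0ℤ ℤ.≤_) (sym (ℤP.*-zeroʳ (σ u * σ w))) (ℤ.+≤+ ℕ.z≤n)
      ... | true  | false = subst (0ℤ ℤ.≤_) (sym (trans (ℤP.*-identityʳ (σ u * σ w)) σuσw≡1)) (ℤ.+≤+ ℕ.z≤n)
        where σuσw≡1 = σ-common-neighbour u→v w-out (subst T (sym v~w) _) (subst T u~w)
      ... | false | true  = subst (0ℤ ℤ.≤_) (sym (cong (_* -1ℤ) σuσw≡-1)) (ℤ.+≤+ ℕ.z≤n)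
        where σuσw≡-1 = σ-adjacent u→v w-out (subst T (sym u~w) _)

      arcSystem-nonneg : All (λ F → ∀ w → 0 < tailCount arcSystem w → 0ℤ ℤ.≤ coeff F w) arcSystem
      arcSystem-nonneg = All.tabulate λ F∈ → case arcSystem-sound F∈ of λ where
        (u , v , u→v , refl) w 0<count → arcForm-nonneg u→v w (subst (0 <_) (tailCount-arcSystem w) 0<count)

    arcSystem-tail-pos : All (λ F → 0ℤ ℤ.< coeff F (tail F)) arcSystem
    arcSystem-tail-pos = All.tabulate λ F∈ → case arcSystem-sound F∈ of λ where
      (u , v , u→v , refl) → arcForm-tail-pos u→v

    neighbourSum-ℤ : ∀ (ℓ : Fin n → ℕ) v → ∑ (λ w → + [ adj G v w ]ᵇ * + ℓ w) ≡ + neighbourSum G ℓ v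
    neighbourSum-ℤ ℓ v = trans (sum-cong-≗ (λ w → indicator (adj G v w) (ℓ w)))
                               (trans (∑-pos (λ w → if adj G v w then ℓ w else 0))
                                      (cong +_ (sym (sum-allFin (λ w → if adj G v w then ℓ w else 0)))))
      where
      indicator : ∀ b x → + [ b ]ᵇ * + x ≡ + (if b then x else 0)
      indicator true  x = ℤP.*-identityˡ (+ x)
      indicator false x = refl

    arcForm-value : ∀ (ℓ : Fin n → ℕ) z → (∀ w → lookup z w ≡ σ w * + ℓ w) → ∀ u v →
                    ⟦ coeff (arcForm u v) ⟧ z ≡ σ u * (+ neighbourSum G ℓ v - + neighbourSum G ℓ u)
    arcForm-value ℓ z z≡σℓ u v = begin
      ∑ (λ w → coeff (arcForm u v) w * lookup z w)         ≡⟨ sum-cong-≗ pointwise ⟩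
      ∑ (λ w → σ u * (nb v w - nb u w))                    ≡⟨ *-distribˡ-sum (σ u) (λ w → nb v w - nb u w) ⟨
      σ u * ∑ (λ w → nb v w - nb u w)                      ≡⟨ cong (σ u *_) (∑-distrib-− (nb v) (nb u)) ⟩
      σ u * (∑ (nb v) - ∑ (nb u))                          ≡⟨ cong₂ (λ a b → σ u * (a - b)) (neighbourSum-ℤ ℓ v) (neighbourSum-ℤ ℓ u) ⟩
      σ u * (+ neighbourSum G ℓ v - + neighbourSum G ℓ u)  ∎
      where
      open ≡-Reasoning
      nb : Fin n → Fin n → ℤ
      nb x w = + [ adj G x w ]ᵇ * + ℓ w
      pointwise : ∀ w → coeff (arcForm u v) w * lookup z w ≡ σ u * (nb v w - nb u w)
      pointwise w = begin
        σ u * σ w * (a - b) * lookup z w         ≡⟨ cong (σ u * σ w * (a - b) *_) (z≡σℓ w) ⟩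
        σ u * σ w * (a - b) * (σ w * + ℓ w)      ≡⟨ gather (σ u) (σ w) a b (+ ℓ w) ⟩
        σ u * (σ w * σ w) * ((a - b) * + ℓ w)    ≡⟨ cong (λ s → σ u * s * ((a - b) * + ℓ w)) (σ-σ w) ⟩
        σ u * 1ℤ * ((a - b) * + ℓ w)             ≡⟨ distribute (σ u) a b (+ ℓ w) ⟩
        σ u * (a * + ℓ w - b * + ℓ w)            ∎
        where
        a = + [ adj G v w ]ᵇ
        b = + [ adj G u w ]ᵇ
        gather : ∀ s t a b x → s * t * (a - b) * (t * x) ≡ s * (t * t) * ((a - b) * x)
        gather = solve-∀
        distribute : ∀ s a b x → s * 1ℤ * ((a - b) * x) ≡ s * (a * x - b * x)
        distribute = solve-∀

    arcForm-separates : ∀ (ℓ : Fin n → ℕ) z → (∀ w → lookup z w ≡ σ w * + ℓ w) → ∀ u v →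
                        ⟦ coeff (arcForm u v) ⟧ z ≢ 0ℤ → neighbourSum G ℓ u ≢ neighbourSum G ℓ v
    arcForm-separates ℓ z z≡σℓ u v ≢0 cu≡cv = ≢0 (begin
      ⟦ coeff (arcForm u v) ⟧ z                             ≡⟨ arcForm-value ℓ z z≡σℓ u v ⟩
      σ u * (+ neighbourSum G ℓ v - + neighbourSum G ℓ u)   ≡⟨ cong (λ c → σ u * (+ neighbourSum G ℓ v - + c)) cu≡cv ⟩
      σ u * (+ neighbourSum G ℓ v - + neighbourSum G ℓ v)   ≡⟨ cong (σ u *_) (ℤP.+-inverseʳ (+ neighbourSum G ℓ v)) ⟩
      σ u * 0ℤ                                              ≡⟨ ℤP.*-zeroʳ (σ u) ⟩
      0ℤ                                                    ∎)
      where open ≡-Reasoning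

    nonvanishing⇒additive : ∀ (ℓ : Fin n → ℕ) z → (∀ w → lookup z w ≡ σ w * + ℓ w) →
      All (λ F → ⟦ coeff F ⟧ z ≢ 0ℤ) arcSystem → ∀ u v → T (adj G u v) → neighbourSum G ℓ u ≢ neighbourSum G ℓ v
    nonvanishing⇒additive ℓ z z≡σℓ nonzero u v u~v with adj⇒arc D u v u~v
    ... | inj₁ u→v = arcForm-separates ℓ z z≡σℓ u v (All.lookup nonzero (arcSystem-complete u→v))
    ... | inj₂ v→u = arcForm-separates ℓ z z≡σℓ v u (All.lookup nonzero (arcSystem-complete v→u)) ∘ sym

    signedList : (Fin n → List ℕ) → Fin n → List ℤ
    signedList L w = map (λ a → σ w * + a) (L w)

    signedList-unique : ∀ L w → Unique (L w) → Unique (signedList L w)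
    signedList-unique L w = UniqueP.map⁺ λ {a} {b} eq → ℤP.+-injective (begin
      + a                   ≡⟨ unsign a ⟨
      σ w * (σ w * + a)     ≡⟨ cong (σ w *_) eq ⟩
      σ w * (σ w * + b)     ≡⟨ unsign b ⟩
      + b                   ∎)
      where
      open ≡-Reasoning
      unsign : ∀ x → σ w * (σ w * + x) ≡ + x
      unsign x = trans (sym (ℤP.*-assoc (σ w) (σ w) (+ x))) (trans (cong (_* + x) (σ-σ w)) (ℤP.*-identityˡ (+ x)))

    signedList-length : ∀ L w → length (L w) ≡ suc (outdeg D w) → length (signedList L w) ≡ suc (tailCount arcSystem w)
    signedList-length L w len =
      trans (ListP.length-map (λ a → σ w * + a) (L w)) (trans len (cong suc (sym (tailCount-arcSystem w))))

    signedGrid-decode : ∀ L z → InGrid (signedList L) z →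
      Σ (Fin n → ℕ) λ ℓ → (∀ w → ℓ w ∈ L w) × (∀ w → lookup z w ≡ σ w * + ℓ w)
    signedGrid-decode L z z∈ = proj₁ ∘ preimage , proj₁ ∘ proj₂ ∘ preimage , proj₂ ∘ proj₂ ∘ preimage
      where
      preimage : ∀ w → ∃[ a ] a ∈ L w × lookup z w ≡ σ w * + a
      preimage w = MemP.∈-map⁻ (λ a → σ w * + a) (z∈ w)

  odd-cycles-leave-non-sinks : (∀ C → IsOddCycle G C → ∃[ u ] (u ∈ C × Simplicial G u × outdeg D u ≡ 0)) →
                                ∀ C → IsOddCycle G C → ¬ All (¬_ ∘ SimplicialSink) C
  odd-cycles-leave-non-sinks sink-on-odd C odd all-non-sinks with sink-on-odd C odd
  ... | u , u∈C , sink = All.lookup all-non-sinks u∈C sink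

mainTheorem5 : (n : ℕ) (G : Graph n) (D : Orientation G)
    (L : Fin n → List ℕ) →
    (∀ v → length (L v) ≡ suc (outdeg D v)) →
    (∀ v → Unique (L v)) →
    (∀ v → All (λ a → 1 ≤ a) (L v)) →
    (∀ (C : List (Fin n)) → IsOddCycle G C →
       ∃[ u ] (u ∈ C × Simplicial G u × outdeg D u ≡ 0)) →
    ∃[ ℓ ] (IsAdditiveColoring G ℓ × (∀ v → ℓ v ∈ L v))
mainTheorem5 n G D L L-length L-unique L-positive sink-on-odd-cycles =
  ℓ , ((λ v → All.lookup (L-positive v) (ℓ∈L v)) , nonvanishing⇒additive ℓ z z≡σℓ nonzero) , ℓ∈L
  where
  colouring = properColouring G (¬? ∘ simplicialSink? G D) (odd-cycles-leave-non-sinks G D sink-on-odd-cycles)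
  open ArcForms G D (proj₁ colouring)

  point : ∃[ z ] InGrid (signedList L) z × All (λ F → ⟦ coeff F ⟧ z ≢ 0ℤ) arcSystem
  point = nonvanishingPoint arcSystem (signedList L)
    (λ w → signedList-unique L w (L-unique w)) (λ w → signedList-length L w (L-length w))
    (arcSystem-nonneg (proj₂ colouring)) arcSystem-tail-pos

  z = proj₁ point
  nonzero = proj₂ (proj₂ point)
  decoded = signedGrid-decode L z (proj₁ (proj₂ point))
  ℓ = proj₁ decoded
  ℓ∈L = proj₁ (proj₂ decoded)
  z≡σℓ = proj₂ (proj₂ decoded)
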